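{- There exist a cop-win graph $G$ of finite corner rank and a Lower Way strategy for the cop on $G$ that is not a Catching strategy.
   Context: All graphs are finite, nonempty and reflexive (every vertex adjacent to itself). For distinct vertices $v,w$ of a graph $H$: $w$ corners $v$ in $H$ if every vertex of $H$ adjacent to $v$ is adjacent to $w$; $w$ strictly corners $v$ in $H$ if moreover some vertex of $H$ adjacent to $w$ is not adjacent to $v$; a strict corner of $H$ is a vertex strictly cornered in $H$ by another vertex. We also say $c$ corners $x$ in $H$ when $c=x$. Corner ranking: $G_1=G$, $k=1$. If $G_k$ is a clique, its vertices get rank $k$; stop. Else if $G_k$ has no strict corners, its vertices get rank $\infty$; stop. Else the set $X$ of strict corners of $G_k$ gets rank $k$, $G_{k+1}=G_k-X$, increase $k$, repeat. $\mathrm{cr}(v)$ is the rank of $v$, $\mathrm{cr}(G)$ the maximum rank. For finite corner rank $\alpha\ge2$: $G$ is $1$-cop-win ($r=1$) if some (equivalently every) vertex of rank $\alpha$ is adjacent to all vertices of $G_{\alpha-1}$, otherwise $0$-cop-win ($r=0$). Projections: $f_k(\{u\})=\{u\}$ if $\mathrm{cr}(u)>k$, otherwise the set of vertices of $G_{k+1}$ that strictly corner $u$ in $G_k$; $f_k(S)=\bigcup_{u\in S}f_k(\{u\})$; $F_1$ the identity, $F_k=f_{k-1}\circ\cdots\circ f_1$, $F_k(v)=F_k(\{v\})$. Game: cop places, robber places, then alternate moves with the cop first; a move is staying or moving to an adjacent vertex; the cop wins when both share a vertex. With the cop at $c$ and robber at $x$: $x$ is $0$-cornered if $c=x$; for $k\ge1$,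 $x$ is $k$-cornered by $c$ if some $x'\in F_k(x)$ is cornered by $c$ in the subgraph induced by $V(G_k)\cup\{c\}$; the cop has $k$-caught the robber if $c\in F_k(x)$. A standard initial placement is a vertex adjacent to every vertex of $G_{\alpha-r}$. Lower Way strategy: standard initial placement and, for every $t\ge1$, after $t$ cop moves the cop $k$-corners the robber for some $k\le\alpha-r-t$. Catching strategy: standard initial placement and, for every $t\ge1$, after $t$ cop moves the cop has $k$-caught the robber for some $k\le\alpha-r-t+1$. -}

module Defs where

open import Data.Bool using (Bool; true; false; _∧_; _∨_; not; if_then_else_; T)
open import Data.Nat using (ℕ; zero; suc; _+_; _∸_; _≤_; _<_)
open import Data.Fin using (Fin; toℕ; _≟_)
open import Data.List using (List; allFin)
open import Data.Bool.ListAction using (all; any)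
open import Data.Product using (Σ; ∃; ∃-syntax; _×_; _,_)
open import Data.Sum using (_⊎_)
open import Relation.Nullary using (¬_)
open import Relation.Nullary.Decidable using (⌊_⌋)
open import Relation.Binary.PropositionalEquality using (_≡_; _≢_)

-- Finite, nonempty, reflexive (undirected) graphs on vertex set Fin n.
-- Nonemptiness is enforced where needed (a vertex of rank α exists).

record Graph : Set where
  field
    n      : ℕ
    adj    : Fin n → Fin n → Bool
    adj-refl : ∀ v → adj v v ≡ true
    adj-sym  : ∀ v w → adj v w ≡ adj w v

open Graph public

VSet : Graph → Set
VSet G = Fin (n G) → Bool

module _ (G : Graph) where

  Vtx : Set
  Vtx = Fin (n G)

  allV : (Vtx → Bool) → Bool
  allV p = all p (allFin (n G))

  anyV : (Vtx → Bool) → Bool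
  anyV p = any p (allFin (n G))

  _==_ : Vtx → Vtx → Bool
  v == w = ⌊ v ≟ w ⌋

  _⇒ᵇ_ : Bool → Bool → Bool
  a ⇒ᵇ b = not a ∨ b

  cornersᵇ : VSet G → Vtx → Vtx → Bool
  cornersᵇ S w v = S w ∧ S v ∧ not (w == v)
    ∧ allV (λ u → S u ⇒ᵇ (adj G u v ⇒ᵇ adj G u w))

  strictlyCornersᵇ : VSet G → Vtx → Vtx → Bool
  strictlyCornersᵇ S w v = cornersᵇ S w v
    ∧ anyV (λ u → S u ∧ adj G u w ∧ not (adj G u v))

  strictCornerᵇ : VSet G → Vtx → Bool
  strictCornerᵇ S v = S v ∧ anyV (λ w → strictlyCornersᵇ S w v)

  cliqueᵇ : VSet G → Bool
  cliqueᵇ S = allV (λ u → allV (λ v → S u ⇒ᵇ (S v ⇒ᵇ adj G u v)))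

  emptySet fullSet : VSet G
  emptySet _ = false
  fullSet _ = true

  -- If the current graph is a clique,
  -- all its vertices are ranked and the process stops (we continue with the
  -- empty set, which is never used as a "G_k" in the definitions below for
  -- k ≤ cr(G)).  Otherwise the strict corners are removed (if there are
  -- none, the set is unchanged forever and nothing more gets ranked).
  step : VSet G → VSet G
  step S = if cliqueᵇ S then emptySet
           else (λ v → S v ∧ not (strictCornerᵇ S v))

  stage : ℕ → VSet G
  stage zero = fullSet
  stage (suc k) = step (stage k)

  -- Gs k = vertex set of G_k (1-indexed: Gs 1 = V(G)); Gs 0 = ∅ (unused).
  Gs : ℕ → VSet G
  Gs zero = emptySet
  Gs (suc k) = stage k

  rankIsᵇ : Vtx → ℕ → Bool
  rankIsᵇ v k = Gs k v ∧ (cliqueᵇ (Gs k) ∨ strictCornerᵇ (Gs k) v)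

  rankLeᵇ : Vtx → ℕ → Bool
  rankLeᵇ v zero = rankIsᵇ v zero
  rankLeᵇ v (suc k) = rankLeᵇ v k ∨ rankIsᵇ v (suc k)

  CornerRank : ℕ → Set
  CornerRank α = (∀ v → T (rankLeᵇ v α)) × (∃[ v ] T (rankIsᵇ v α))

  oneCopWinᵇ : ℕ → Bool
  oneCopWinᵇ α = anyV (λ v → rankIsᵇ v α
                        ∧ allV (λ u → Gs (α ∸ 1) u ⇒ᵇ adj G v u))

  rOf : ℕ → ℕ
  rOf α = if oneCopWinᵇ α then 1 else 0

  fSingle : ℕ → Vtx → VSet G
  fSingle k u w =
    if not (rankLeᵇ u k)
    then (w == u)
    else (Gs (suc k) w ∧ strictlyCornersᵇ (Gs k) w u)

  fSet : ℕ → VSet G → VSet G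
  fSet k S w = anyV (λ u → S u ∧ fSingle k u w)

  -- F_1 = id, F_{k+1} = f_k ∘ F_k  (F_0 := id, unused).
  F : ℕ → VSet G → VSet G
  F zero S = S
  F (suc zero) S = S
  F (suc (suc k)) S = fSet (suc k) (F (suc k) S)

  singleton : Vtx → VSet G
  singleton x w = w == x

  cornersOrEqᵇ : VSet G → Vtx → Vtx → Bool
  cornersOrEqᵇ S c x = (c == x) ∨ cornersᵇ S c x

  kCornered : ℕ → Vtx → Vtx → Set
  kCornered zero c x = c ≡ x
  kCornered (suc k) c x =
    ∃[ x' ] T (F (suc k) (singleton x) x'
              ∧ cornersOrEqᵇ (λ v → Gs (suc k) v ∨ (v == c)) c x')

  -- the cop at c has k-caught the robber at x (k ≥ 1, as F_k needs k ≥ 1).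
  kCaught : ℕ → Vtx → Vtx → Set
  kCaught k c x = 1 ≤ k × T (F k (singleton x) c)

  Standard : ℕ → Vtx → Set
  Standard α c = T (allV (λ u → Gs (α ∸ rOf α) u ⇒ᵇ adj G c u))

  -- The game.  The robber's play is a sequence of positions x 0, x 1, …
  -- (x 0 the placement, x (t+1) the position after its (t+1)-st move).
  RobberPlay : Set
  RobberPlay = ℕ → Vtx

  LegalRobber : RobberPlay → Set
  LegalRobber x = ∀ t → T (adj G (x t) (x (suc t)))

  -- A (deterministic, history dependent) cop strategy: an initial vertex
  -- and, for the (t+1)-st move, a choice depending on the robber's
  -- positions x 0 … x t (the cop's own earlier positions are determined by
  -- these).
  record CopStrategy : Set where
    field
      start : Vtx
      move  : (t : ℕ) → (Fin (suc t) → Vtx) → Vtx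

  open CopStrategy public

  copPos : CopStrategy → RobberPlay → ℕ → Vtx
  copPos σ x zero = start σ
  copPos σ x (suc t) = move σ t (λ i → x (toℕ i))

  LegalStrategy : CopStrategy → Set
  LegalStrategy σ = ∀ x → LegalRobber x →
    ∀ t → T (adj G (copPos σ x t) (copPos σ x (suc t)))

  -- the game is still running when the cop makes its (u+1)-st move
  Ongoing : CopStrategy → RobberPlay → ℕ → Set
  Ongoing σ x u = (∀ s → s ≤ u → copPos σ x s ≢ x s)
                × (∀ s → s < u → copPos σ x (suc s) ≢ x s)

  Winning : CopStrategy → Set
  Winning σ = ∀ x → LegalRobber x →
    ∃[ t ] (copPos σ x t ≡ x t ⊎ copPos σ x (suc t) ≡ x t)

  CopWin : Set
  CopWin = ∃[ σ ] (LegalStrategy σ × Winning σ)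

  -- After t = u+1 cop moves, cop at copPos (suc u), robber at x u.
  -- "k ≤ α - r - t" is written k + t + r ≤ α (no truncated subtraction).
  LowerWay : ℕ → CopStrategy → Set
  LowerWay α σ = Standard α (start σ) ×
    (∀ x → LegalRobber x → ∀ u → Ongoing σ x u →
      ∃[ k ] (k + suc u + rOf α ≤ α × kCornered k (copPos σ x (suc u)) (x u)))

  -- "k ≤ α - r - t + 1" written k + t + r ≤ α + 1.
  Catching : ℕ → CopStrategy → Set
  Catching α σ = Standard α (start σ) ×
    (∀ x → LegalRobber x → ∀ u → Ongoing σ x u →
      ∃[ k ] (k + suc u + rOf α ≤ α + 1 × kCaught k (copPos σ x (suc u)) (x u)))

-- In the triangle a a′ b with the path b – c – d attached, the strict corners
-- of the whole graph are a, a′ (cornered by b) and d (cornered by c), leaving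
-- the clique {b, c}: the corner rank is 2 and, as no vertex sees both a and d,
-- r = 0.  A cop starting on b can answer a robber on a by moving to a′, which
-- corners a, and then simply step onto the robber: this meets the Lower Way
-- bounds.  But a′ is neither a = F₁(a) nor in F₂(a) = {b}, so the cop has not
-- caught the robber after its first move, as a Catching strategy requires.
module Submission where

open import Defs
open import Data.Bool using (Bool; true; false; T)
import Data.Bool.Properties as Bool
open import Data.Fin using (Fin; zero; suc; fromℕ)
open import Data.Fin.Properties using (all?; toℕ-fromℕ)
open import Data.Nat using (ℕ; zero; suc; _+_; _≤_; z≤n; s≤s; s≤s⁻¹)
open import Data.Nat.Properties using (+-assoc; +-suc; +-comm)
open import Data.Product using (∃-syntax; _×_; _,_)
open import Data.Sum using (inj₂)
open import Data.Unit using (tt)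
open import Function using (const; _∘′_)
open import Relation.Nullary using (¬_)
open import Relation.Nullary.Decidable using (from-yes; T?; _→-dec_)
open import Relation.Binary.PropositionalEquality
  using (_≡_; _≢_; refl; sym; trans; cong; subst; subst₂)

stationary-legal : (G : Graph) (v : Vtx G) → LegalRobber G (const v)
stationary-legal G v _ = subst T (sym (adj-refl G v)) tt

catching-bound-at-first-move : ∀ k r α → k + 1 + r ≤ α + 1 → k + r ≤ α
catching-bound-at-first-move k r α =
  s≤s⁻¹ ∘′ subst₂ _≤_ (trans (+-assoc k 1 r) (+-suc k r)) (+-comm α 1)

stationary-robber-refutes-Catching :
  (G : Graph) (α : ℕ) (σ : CopStrategy G) (v : Vtx G) →
  start σ ≢ v →
  (∀ k → k + rOf G α ≤ α → ¬ kCaught G k (copPos G σ (const v) 1) v) →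
  ¬ Catching G α σ
stationary-robber-refutes-Catching G α σ v start≢v misses (_ , catching) =
  let k , bound , caught = catching (const v) (stationary-legal G v) 0 ongoing
  in misses k (catching-bound-at-first-move k (rOf G α) α bound) caught
  where
  ongoing : Ongoing G σ (const v) 0
  ongoing = (λ { zero z≤n → start≢v }) , (λ _ ())

module Chase (G : Graph) (s : Vtx G) (m : Vtx G → Vtx G) where

  chase : CopStrategy G
  chase = record { start = s ; move = respond }
    where
    respond : (t : ℕ) → (Fin (suc t) → Vtx G) → Vtx G
    respond zero    robber = m (robber zero)
    respond (suc t) robber = robber (fromℕ (suc t))

  chase-follows : ∀ x t → copPos G chase x (2 + t) ≡ x (1 + t)
  chase-follows x t = cong x (toℕ-fromℕ (suc t))

  chase-legal : (∀ y → T (adj G s (m y))) →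
                (∀ y z → T (adj G y z) → T (adj G (m y) z)) →
                LegalStrategy G chase
  chase-legal s-sees-m _ x _ zero = s-sees-m (x 0)
  chase-legal _ m-corners x legal (suc zero) = m-corners (x 0) (x 1) (legal 0)
  chase-legal _ _ x legal (suc (suc t)) =
    subst₂ (λ p q → T (adj G p q)) (sym (chase-follows x t)) (sym (chase-follows x (suc t)))
      (legal (suc t))

  chase-winning : Winning G chase
  chase-winning x _ = 1 , inj₂ refl

  chase-over-after-two-moves : ∀ x u → ¬ Ongoing G chase x (2 + u)
  chase-over-after-two-moves x u (_ , not-caught) = not-caught 1 (s≤s (s≤s z≤n)) refl

  chase-lowerWay : ∀ α → Standard G α s → 2 + rOf G α ≤ α →
                   (∀ y → kCornered G 1 (m y) y) →
                   LowerWay G α chase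
  chase-lowerWay α standard bound m-corners = standard , cornered
    where
    cornered : ∀ x → LegalRobber G x → ∀ u → Ongoing G chase x u →
               ∃[ k ] (k + suc u + rOf G α ≤ α × kCornered G k (copPos G chase x (suc u)) (x u))
    cornered x _ zero          _       = 1 , bound , m-corners (x 0)
    cornered x _ (suc zero)    _       = 0 , bound , refl
    cornered x _ (suc (suc u)) ongoing with chase-over-after-two-moves x u ongoing
    ... | ()

pattern a  = zero
pattern a′ = suc zero
pattern b  = suc (suc zero)
pattern c  = suc (suc (suc zero))
pattern d  = suc (suc (suc (suc zero)))

adjacent : Fin 5 → Fin 5 → Bool
adjacent a  c  = false
adjacent a  d  = false
adjacent a′ c  = false
adjacent a′ d  = false
adjacent b  d  = false
adjacent c  a  = false
adjacent c  a′ = false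
adjacent d  a  = false
adjacent d  a′ = false
adjacent d  b  = false
adjacent _  _  = true

example : Graph
example = record
  { n        = 5
  ; adj      = adjacent
  ; adj-refl = from-yes (all? λ v → adjacent v v Bool.≟ true)
  ; adj-sym  = from-yes (all? λ v → all? λ w → adjacent v w Bool.≟ adjacent w v)
  }

-- a′ rather than b answers a: it corners a without lying in any projection of a.
firstMove : Fin 5 → Fin 5
firstMove a  = a′
firstMove a′ = a
firstMove b  = b
firstMove c  = c
firstMove d  = c

example-cornerRank : CornerRank example 2
example-cornerRank = from-yes (all? λ v → T? (rankLeᵇ example v 2)) , b , tt

b-sees-firstMove : ∀ y → T (adjacent b (firstMove y))
b-sees-firstMove = from-yes (all? λ y → T? (adjacent b (firstMove y)))

firstMove-corners : ∀ y z → T (adjacent y z) → T (adjacent (firstMove y) z)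
firstMove-corners =
  from-yes (all? λ y → all? λ z → T? (adjacent y z) →-dec T? (adjacent (firstMove y) z))

firstMove-1-corners : ∀ y → kCornered example 1 (firstMove y) y
firstMove-1-corners a  = a  , tt
firstMove-1-corners a′ = a′ , tt
firstMove-1-corners b  = b  , tt
firstMove-1-corners c  = c  , tt
firstMove-1-corners d  = d  , tt

a′-misses-a : ∀ k → k + 0 ≤ 2 → ¬ kCaught example k a′ a
a′-misses-a zero    _ (() , _)
a′-misses-a 1       _ (_ , ())
a′-misses-a 2       _ (_ , ())
a′-misses-a (suc (suc (suc _))) (s≤s (s≤s ())) _

open Chase example b firstMove

theorem7p1 : ∃[ G ] ∃[ α ] (CornerRank G α × 2 ≤ α × CopWin G
    × ∃[ σ ] (LegalStrategy G σ × LowerWay G α σ × ¬ Catching G α σ))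
theorem7p1 =
  example , 2 , example-cornerRank , s≤s (s≤s z≤n) , (chase , legal , chase-winning) ,
  chase , legal , chase-lowerWay 2 tt (s≤s (s≤s z≤n)) firstMove-1-corners ,
  stationary-robber-refutes-Catching example 2 chase a (λ ()) a′-misses-a
  where
  legal : LegalStrategy example chase
  legal = chase-legal b-sees-firstMove firstMove-corners
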